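{- Let $G$ be a finitely generated Abelian group, $e\in G$ an element of order $2$, and $L>2$. Then the property of a function $\alpha:G\to\mathbb{Z}/L\mathbb{Z}$ being $e$-boolean is expressible, with a witnessing system of functional equations constructible explicitly from the data.
   Context: A function $\alpha:G\to\mathbb{Z}/L\mathbb{Z}$ is $e$-boolean if it takes values in $\{ -1,+1\}\subset\mathbb{Z}/L\mathbb{Z}$ and $\alpha(x+e)=-\alpha(x)$ for all $x\in G$. For $G$ finitely generated Abelian and $H$ finite Abelian, a $(G,H)$-property is a set $P$ of functions $\alpha:G\to H$. It is expressible if there exist $M\in\mathbb{N}$, and for $i=1,\dots,M$ numbers $J_i$, sets $E'_i\subset H$, shifts $h_{i,j}\in G$ and sets $E_{i,j}\subset H$ ($j\le J_i$), such that $\alpha\in P$ iff for all $i$ and $x\in G$ the sets $\alpha(x+h_{i,j})+E_{i,j}$ ($j=1,\dots,J_i$) are pairwise disjoint with union $E'_i$ (the witnessing system). -}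

module Defs where

open import Level using (Level; _⊔_)
import Level
open import Data.Nat using (ℕ; zero; suc; _+_; _∸_; NonZero)
open import Data.Nat.DivMod using (_mod_)
open import Data.Integer using (ℤ; +_; -[1+_])
open import Data.Fin using (Fin; toℕ)
open import Data.Fin.Subset using (Subset; _∈_)
open import Data.Product using (Σ; ∃; _×_; _,_)
open import Data.Sum using (_⊎_)
open import Relation.Nullary using (¬_)
open import Relation.Binary.PropositionalEquality using (_≡_; _≢_)
open import Function.Bundles using (_⇔_)
open import Algebra.Bundles using (AbelianGroup)

module ZMod (L : ℕ) .{{_ : NonZero L}} where

  H : Set
  H = Fin L

  _+H_ : H → H → H
  a +H b = (toℕ a + toℕ b) mod L

  -H_ : H → H
  -H a = (L ∸ toℕ a) mod L

  oneH : H
  oneH = 1 mod L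

  minusOneH : H
  minusOneH = (L ∸ 1) mod L

  _∈+_ : H → (H × Subset L) → Set
  z ∈+ (a , E) = ∃ λ y → y ∈ E × z ≡ a +H y

module GroupDefs {c ℓ : Level} (G : AbelianGroup c ℓ) where
  open AbelianGroup G

  _×ₙ_ : ℕ → Carrier → Carrier
  zero ×ₙ g = ε
  suc n ×ₙ g = g ∙ (n ×ₙ g)

  _·_ : ℤ → Carrier → Carrier
  (+ n) · g = n ×ₙ g
  -[1+ n ] · g = (suc n ×ₙ g) ⁻¹

  ∑ : (n : ℕ) → (Fin n → Carrier) → Carrier
  ∑ zero f = ε
  ∑ (suc n) f = f Fin.zero ∙ ∑ n (λ i → f (Fin.suc i))
    where import Data.Fin as Fin

  FinitelyGenerated : Set (c ⊔ ℓ)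
  FinitelyGenerated =
    Σ ℕ λ n → Σ (Fin n → Carrier) λ g →
      ∀ x → Σ (Fin n → ℤ) λ k → x ≈ ∑ n (λ i → k i · g i)

  HasOrder2 : Carrier → Set ℓ
  HasOrder2 e = ¬ (e ≈ ε) × (e ∙ e ≈ ε)

  Respects : {A : Set} → (Carrier → A) → Set (c ⊔ ℓ)
  Respects α = ∀ {x y} → x ≈ y → α x ≡ α y

module Expressibility {c ℓ : Level} (G : AbelianGroup c ℓ)
                      (L : ℕ) .{{_ : NonZero L}} where
  open AbelianGroup G
  open ZMod L
  open GroupDefs G

  Property : Set (Level.suc c)
  Property = (Carrier → H) → Set c

  record System : Set c where
    field
      M  : ℕ
      J  : Fin M → ℕ
      E′ : Fin M → Subset L
      h  : (i : Fin M) → Fin (J i) → Carrier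
      E  : (i : Fin M) → Fin (J i) → Subset L

  DisjointUnion : {J : ℕ} → (Fin J → H → Set) → Subset L → Set
  DisjointUnion {J} F U =
    (∀ j k → j ≢ k → ∀ z → ¬ (F j z × F k z)) ×
    (∀ z → (z ∈ U) ⇔ (∃ λ j → F j z))

  Satisfies : System → (Carrier → H) → Set c
  Satisfies S α =
    ∀ i x → DisjointUnion (λ j z → z ∈+ (α (x ∙ h i j) , E i j)) (E′ i)
    where open System S

  ExpressedBy : Property → System → Set (c ⊔ ℓ)
  ExpressedBy P S = ∀ (α : Carrier → H) → Respects α → (P α ⇔ Satisfies S α)

  Expressible : Property → Set (c ⊔ ℓ)
  Expressible P = Σ System λ S → ExpressedBy P S

  EBoolean : Carrier → Property
  EBoolean e α =
    (∀ x → α x ≡ oneH ⊎ α x ≡ minusOneH) ×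
    (∀ x → α (x ∙ e) ≡ -H (α x))

{-# OPTIONS --safe #-}
-- The system has a single equation with shifts 0 and e, every E i j = {0}
-- and E′ = {1, −1}: it says that α(x) and α(x + e) are distinct and together
-- make up {1, −1}.  Since 1 ≠ −1 in ℤ/Lℤ for L > 2, this is the same as
-- α(x) ∈ {1, −1} and α(x + e) = −α(x).
module Submission where

open import Defs
open import Level using (Level)
open import Data.Nat using (ℕ; suc; _+_; _<_; _∸_; s≤s; NonZero)
open import Data.Nat.DivMod using (_mod_; _%_; m<n⇒m%n≡m)
open import Data.Nat.Properties using (n<1+n; n≤1+n; m+n∸n≡m; +-identityʳ; ≤-trans; <⇒≢)
open import Algebra.Bundles using (AbelianGroup)
open import Data.Fin using (Fin; toℕ)
import Data.Fin as Fin
open import Data.Fin.Properties using (toℕ-fromℕ<; toℕ<n; toℕ-injective)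
open import Data.Fin.Subset using (_∈_; ⁅_⁆; _∪_)
open import Data.Fin.Subset.Properties using (x∈⁅x⁆; x∈⁅y⁆⇒x≡y; x∈⁅y⁆⇔x≡y; ∪⇔⊎)
open import Data.Vec.Functional using (_∷_; [])
open import Data.Product using (∃; _×_; _,_; proj₁; proj₂)
open import Data.Sum using (_⊎_; inj₁; inj₂; swap)
open import Data.Sum.Function.Propositional using (_⊎-⇔_)
open import Relation.Nullary using (contradiction)
open import Relation.Binary.PropositionalEquality
  using (_≡_; _≢_; refl; sym; trans; cong; ≢-sym; module ≡-Reasoning)
open import Function.Bundles using (_⇔_; mk⇔; Equivalence)
import Function.Properties.Equivalence as ⇔

module _ {A : Set} where

  SameUnorderedPair : A → A → A → A → Set
  SameUnorderedPair a b u v = (a ≡ u × b ≡ v) ⊎ (a ≡ v × b ≡ u)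

  distinct-members⇒SameUnorderedPair : ∀ {a b u v} → a ≢ b →
    (a ≡ u ⊎ a ≡ v) → (b ≡ u ⊎ b ≡ v) → SameUnorderedPair a b u v
  distinct-members⇒SameUnorderedPair a≢b (inj₁ a≡u) (inj₁ b≡u) =
    contradiction (trans a≡u (sym b≡u)) a≢b
  distinct-members⇒SameUnorderedPair a≢b (inj₁ a≡u) (inj₂ b≡v) = inj₁ (a≡u , b≡v)
  distinct-members⇒SameUnorderedPair a≢b (inj₂ a≡v) (inj₁ b≡u) = inj₂ (a≡v , b≡u)
  distinct-members⇒SameUnorderedPair a≢b (inj₂ a≡v) (inj₂ b≡v) =
    contradiction (trans a≡v (sym b≡v)) a≢b

  SameUnorderedPair⇒distinct : ∀ {a b u v} → u ≢ v →
    SameUnorderedPair a b u v → a ≢ b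
  SameUnorderedPair⇒distinct u≢v (inj₁ (refl , refl)) = u≢v
  SameUnorderedPair⇒distinct u≢v (inj₂ (refl , refl)) = ≢-sym u≢v

  SameUnorderedPair⇒members⇔ : ∀ {a b u v z} → SameUnorderedPair a b u v →
    (z ≡ a ⊎ z ≡ b) ⇔ (z ≡ u ⊎ z ≡ v)
  SameUnorderedPair⇒members⇔ (inj₁ (refl , refl)) = ⇔.refl
  SameUnorderedPair⇒members⇔ (inj₂ (refl , refl)) = mk⇔ swap swap

  pair-injective : ∀ {a b : A} {j k} → a ≢ b →
    (a ∷ b ∷ []) j ≡ (a ∷ b ∷ []) k → j ≡ k
  pair-injective {j = Fin.zero}          {Fin.zero}          a≢b _   = refl
  pair-injective {j = Fin.zero}          {Fin.suc Fin.zero}  a≢b a≡b = contradiction a≡b a≢b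
  pair-injective {j = Fin.suc Fin.zero}  {Fin.zero}          a≢b b≡a = contradiction (sym b≡a) a≢b
  pair-injective {j = Fin.suc Fin.zero}  {Fin.suc Fin.zero}  a≢b _   = refl

  ∃-pair⇔ : ∀ {a b z : A} → (∃ λ j → z ≡ (a ∷ b ∷ []) j) ⇔ (z ≡ a ⊎ z ≡ b)
  ∃-pair⇔ = mk⇔ to from
    where
    to : ∀ {a b z} → (∃ λ j → z ≡ (a ∷ b ∷ []) j) → z ≡ a ⊎ z ≡ b
    to (Fin.zero , z≡a) = inj₁ z≡a
    to (Fin.suc Fin.zero , z≡b) = inj₂ z≡b
    from : ∀ {a b z} → z ≡ a ⊎ z ≡ b → ∃ λ j → z ≡ (a ∷ b ∷ []) j
    from (inj₁ z≡a) = Fin.zero , z≡a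
    from (inj₂ z≡b) = Fin.suc Fin.zero , z≡b

∈-⁅⁆∪⁅⁆⇔ : ∀ {n} {z u v : Fin n} → z ∈ ⁅ u ⁆ ∪ ⁅ v ⁆ ⇔ (z ≡ u ⊎ z ≡ v)
∈-⁅⁆∪⁅⁆⇔ = ⇔.trans ∪⇔⊎ (x∈⁅y⁆⇔x≡y ⊎-⇔ x∈⁅y⁆⇔x≡y)

module ZModProperties (k : ℕ) where
  open ZMod (suc k)

  toℕ-mod : ∀ m → toℕ (m mod suc k) ≡ m % suc k
  toℕ-mod m = toℕ-fromℕ< _

  +H-identityʳ : ∀ a → a +H Fin.zero ≡ a
  +H-identityʳ a = toℕ-injective (begin
    toℕ ((toℕ a + 0) mod suc k) ≡⟨ toℕ-mod (toℕ a + 0) ⟩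
    (toℕ a + 0) % suc k         ≡⟨ cong (_% suc k) (+-identityʳ (toℕ a)) ⟩
    toℕ a % suc k               ≡⟨ m<n⇒m%n≡m (toℕ<n a) ⟩
    toℕ a                       ∎)
    where open ≡-Reasoning

  ∈+⁅0⁆⇔ : ∀ {z a} → z ∈+ (a , ⁅ Fin.zero ⁆) ⇔ z ≡ a
  ∈+⁅0⁆⇔ {z} {a} = mk⇔ to from
    where
    to : z ∈+ (a , ⁅ Fin.zero ⁆) → z ≡ a
    to (y , y∈⁅0⁆ , z≡a+y) =
      trans z≡a+y (trans (cong (a +H_) (x∈⁅y⁆⇒x≡y _ y∈⁅0⁆)) (+H-identityʳ a))
    from : z ≡ a → z ∈+ (a , ⁅ Fin.zero ⁆)
    from z≡a = Fin.zero , x∈⁅x⁆ _ , trans z≡a (sym (+H-identityʳ a))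

  toℕ-oneH : 0 < k → toℕ oneH ≡ 1
  toℕ-oneH 0<k = trans (toℕ-mod 1) (m<n⇒m%n≡m (s≤s 0<k))

  toℕ-minusOneH : toℕ minusOneH ≡ k
  toℕ-minusOneH = trans (toℕ-mod k) (m<n⇒m%n≡m (n<1+n k))

  -H-oneH : 0 < k → -H oneH ≡ minusOneH
  -H-oneH 0<k = cong (λ t → (suc k ∸ t) mod suc k) (toℕ-oneH 0<k)

  -H-minusOneH : -H minusOneH ≡ oneH
  -H-minusOneH = trans (cong (λ t → (suc k ∸ t) mod suc k) toℕ-minusOneH)
                       (cong (_mod suc k) (m+n∸n≡m 1 k))

  oneH≢minusOneH : 1 < k → oneH ≢ minusOneH
  oneH≢minusOneH 1<k 1≡-1 = <⇒≢ 1<k (begin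
    1               ≡⟨ sym (toℕ-oneH (≤-trans (n≤1+n 1) 1<k)) ⟩
    toℕ oneH        ≡⟨ cong toℕ 1≡-1 ⟩
    toℕ minusOneH   ≡⟨ toℕ-minusOneH ⟩
    k               ∎)
    where open ≡-Reasoning

  boolean×negated⇔SameUnorderedPair : 0 < k → ∀ {a b} →
    ((a ≡ oneH ⊎ a ≡ minusOneH) × b ≡ -H a) ⇔ SameUnorderedPair a b oneH minusOneH
  boolean×negated⇔SameUnorderedPair 0<k = mk⇔ to from
    where
    to : ∀ {a b} → (a ≡ oneH ⊎ a ≡ minusOneH) × b ≡ -H a →
         SameUnorderedPair a b oneH minusOneH
    to (inj₁ refl , refl) = inj₁ (refl , -H-oneH 0<k)
    to (inj₂ refl , refl) = inj₂ (refl , -H-minusOneH)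
    from : ∀ {a b} → SameUnorderedPair a b oneH minusOneH →
           (a ≡ oneH ⊎ a ≡ minusOneH) × b ≡ -H a
    from (inj₁ (refl , refl)) = inj₁ refl , sym (-H-oneH 0<k)
    from (inj₂ (refl , refl)) = inj₂ refl , sym -H-minusOneH

module _ {c ℓ : Level} (G : AbelianGroup c ℓ) {L : ℕ} .{{_ : NonZero L}} where
  open Expressibility G L using (DisjointUnion)

  DisjointUnion-cong : ∀ {J} {F F′ : Fin J → Fin L → Set} {U} →
    (∀ j z → F j z ⇔ F′ j z) → DisjointUnion F U ⇔ DisjointUnion F′ U
  DisjointUnion-cong F⇔F′ = mk⇔ (transport F⇔F′) (transport (λ j z → ⇔.sym (F⇔F′ j z)))
    where
    transport : ∀ {J} {F F′ : Fin J → Fin L → Set} {U} →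
      (∀ j z → F j z ⇔ F′ j z) → DisjointUnion F U → DisjointUnion F′ U
    transport F⇔F′ (disjoint , cover) =
      (λ j k j≢k z (p , q) → disjoint j k j≢k z (from (F⇔F′ j z) p , from (F⇔F′ k z) q)) ,
      (λ z → ⇔.trans (cover z)
        (mk⇔ (λ (j , p) → j , to (F⇔F′ j z) p) (λ (j , p) → j , from (F⇔F′ j z) p)))
      where open Equivalence

  disjointUnion-pair⇔ : ∀ {a b u v} → u ≢ v →
    DisjointUnion (λ j z → z ≡ (a ∷ b ∷ []) j) (⁅ u ⁆ ∪ ⁅ v ⁆) ⇔ SameUnorderedPair a b u v
  disjointUnion-pair⇔ {a} {b} {u} {v} u≢v = mk⇔ to from
    where
    open Equivalence using () renaming (to to ⇒; from to ⇐)
    to : DisjointUnion (λ j z → z ≡ (a ∷ b ∷ []) j) (⁅ u ⁆ ∪ ⁅ v ⁆) → SameUnorderedPair a b u v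
    to (disjoint , cover) =
      distinct-members⇒SameUnorderedPair a≢b (member (inj₁ refl)) (member (inj₂ refl))
      where
      a≢b : a ≢ b
      a≢b a≡b = disjoint Fin.zero (Fin.suc Fin.zero) (λ ()) a (refl , a≡b)
      member : ∀ {w} → w ≡ a ⊎ w ≡ b → w ≡ u ⊎ w ≡ v
      member {w} w∈ab = ⇒ ∈-⁅⁆∪⁅⁆⇔ (⇐ (cover w) (⇐ ∃-pair⇔ w∈ab))
    from : SameUnorderedPair a b u v → DisjointUnion (λ j z → z ≡ (a ∷ b ∷ []) j) (⁅ u ⁆ ∪ ⁅ v ⁆)
    from same =
      (λ j k j≢k z (z≡pj , z≡pk) →
         j≢k (pair-injective (SameUnorderedPair⇒distinct u≢v same) (trans (sym z≡pj) z≡pk))) ,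
      (λ z → ⇔.trans ∈-⁅⁆∪⁅⁆⇔ (⇔.sym (⇔.trans ∃-pair⇔ (SameUnorderedPair⇒members⇔ same))))

module BooleanSystem {c ℓ : Level} (G : AbelianGroup c ℓ) (k : ℕ) where
  open AbelianGroup G using (Carrier; _∙_; ε; identityʳ)
  open GroupDefs G using (Respects)
  open ZMod (suc k)
  open ZModProperties k
  open Expressibility G (suc k)

  booleanSystem : Carrier → System
  booleanSystem e = record
    { M  = 1
    ; J  = λ _ → 2
    ; E′ = λ _ → ⁅ oneH ⁆ ∪ ⁅ minusOneH ⁆
    ; h  = λ _ → ε ∷ e ∷ []
    ; E  = λ _ _ → ⁅ Fin.zero ⁆
    }

  satisfies⇔ : 1 < k → ∀ {e α} → Respects α →
    Satisfies (booleanSystem e) α ⇔ (∀ x → SameUnorderedPair (α x) (α (x ∙ e)) oneH minusOneH)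
  satisfies⇔ 1<k {e} {α} resp =
    mk⇔ (λ sat x → to (equation x) (sat Fin.zero x)) (λ same _ x → from (equation x) (same x))
    where
    open Equivalence
    equation : ∀ x →
      DisjointUnion (λ j z → z ∈+ (α (x ∙ (ε ∷ e ∷ []) j) , ⁅ Fin.zero ⁆)) (⁅ oneH ⁆ ∪ ⁅ minusOneH ⁆)
        ⇔ SameUnorderedPair (α x) (α (x ∙ e)) oneH minusOneH
    equation x = ⇔.trans (DisjointUnion-cong G shifted) (disjointUnion-pair⇔ G (oneH≢minusOneH 1<k))
      where
      shifted : ∀ j z →
        z ∈+ (α (x ∙ (ε ∷ e ∷ []) j) , ⁅ Fin.zero ⁆) ⇔ z ≡ (α x ∷ α (x ∙ e) ∷ []) j
      shifted Fin.zero z rewrite resp (identityʳ x) = ∈+⁅0⁆⇔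
      shifted (Fin.suc Fin.zero) z = ∈+⁅0⁆⇔

  eBoolean⇔ : 0 < k → ∀ {e α} →
    EBoolean e α ⇔ (∀ x → SameUnorderedPair (α x) (α (x ∙ e)) oneH minusOneH)
  eBoolean⇔ 0<k = mk⇔
    (λ (boolean , negated) x → to pointwise (boolean x , negated x))
    (λ same → (λ x → proj₁ (from pointwise (same x))) , (λ x → proj₂ (from pointwise (same x))))
    where
    open Equivalence
    pointwise : ∀ {a b} →
      ((a ≡ oneH ⊎ a ≡ minusOneH) × b ≡ -H a) ⇔ SameUnorderedPair a b oneH minusOneH
    pointwise = boolean×negated⇔SameUnorderedPair 0<k

  booleanSystem-expresses : 1 < k → ∀ e → ExpressedBy (EBoolean e) (booleanSystem e)
  booleanSystem-expresses 1<k e α resp =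
    ⇔.trans (eBoolean⇔ (≤-trans (n≤1+n 1) 1<k)) (⇔.sym (satisfies⇔ 1<k resp))

lemma6p11 : {c ℓ : Level} (G : AbelianGroup c ℓ) → GroupDefs.FinitelyGenerated G →
    (e : AbelianGroup.Carrier G) → GroupDefs.HasOrder2 G e →
    (L : ℕ) .{{_ : NonZero L}} → 2 < L →
    Expressibility.Expressible G L (Expressibility.EBoolean G L e)
lemma6p11 G _ e _ (suc k) (s≤s 1<k) = booleanSystem e , booleanSystem-expresses 1<k e
  where open BooleanSystem G k
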